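{- Let $p$ be a prime and let $D$ be a positive integer with $D \not\equiv 0 \pmod p$. Let $A_1,\dots,A_k \subseteq \mathbb{Z}_p$ be $D$-APs. Then the sumset $\sum_{i=1}^k A_i$ is contiguous relative to $D$.
   Context: $\mathbb{Z}_p=\{0,\dots,p-1\}$ under addition modulo $p$. The sumset is $\sum_{i=1}^k A_i = \{a_1+\dots+a_k \bmod p : a_i\in A_i\}$. For $b\in\{0,\dots,D-1\}$, the $D$-AP with base $b$ is $A_{(b)} = \{b+iD : i\ge 0,\ b+iD<p\}\subseteq \mathbb{Z}_p$; a $D$-AP is a set of this form. For $g_0,g_1\in\mathbb{Z}_p$, the distance relative to $p,D$ is $\mathrm{dist}_{p,D}(g_0,g_1)=\min\{(g_1-g_0)D^{ -1}\bmod p,\ (g_0-g_1)D^{ -1}\bmod p\}$, each term viewed as an integer in $\{0,\dots,p-1\}$. Elements $g_0,g_1$ are adjacent if $\mathrm{dist}_{p,D}(g_0,g_1)=1$. A set $A\subseteq\mathbb{Z}_p$ is contiguous relative to $D$ if its elements can be ordered so that any two consecutive elements in the ordering are adjacent; a one-element set is contiguous. -}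

module Defs where

open import Data.Nat using (ℕ; zero; suc; _+_; _*_; _∸_; _^_; _<_; _⊓_; NonZero)
open import Data.Nat.DivMod using (_%_)
open import Data.Fin using (Fin)
open import Data.Product using (Σ; ∃; _×_)
open import Data.List using (List)
open import Data.List.Membership.Propositional using (_∈_)
open import Data.List.Relation.Unary.Unique.Propositional using (Unique)
open import Data.List.Relation.Unary.Linked using (Linked)
open import Relation.Binary.PropositionalEquality using (_≡_)
open import Function.Bundles using (_⇔_)

-- Elements of ℤ_p are represented by natural numbers x with x < p.
-- Subsets of ℤ_p are predicates on ℕ (only meaningful on values < p).

AP : (p D b : ℕ) → ℕ → Set
AP p D b x = (x < p) × (∃ λ i → x ≡ b + i * D)

Sumset : (p : ℕ) .{{_ : NonZero p}} → (k : ℕ) → (Fin k → ℕ → Set) → ℕ → Set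
Sumset p k A x =
  Σ (Fin k → ℕ) λ a → ((i : Fin k) → A i (a i)) × (x ≡ sumFin k a % p)
  where
  sumFin : (n : ℕ) → (Fin n → ℕ) → ℕ
  sumFin zero    f = 0
  sumFin (suc n) f = f Fin.zero + sumFin n (λ j → f (Fin.suc j))

-- Inverse of D modulo the prime p (Fermat): D^{-1} = D^(p-2) mod p.
inv : (p : ℕ) .{{_ : NonZero p}} → ℕ → ℕ
inv p D = (D ^ (p ∸ 2)) % p

subMod : (p : ℕ) .{{_ : NonZero p}} → ℕ → ℕ → ℕ
subMod p y x = (y + (p ∸ x)) % p

dist : (p : ℕ) .{{_ : NonZero p}} → ℕ → ℕ → ℕ → ℕ
dist p D g0 g1 =
  ((subMod p g1 g0 * inv p D) % p) ⊓ ((subMod p g0 g1 * inv p D) % p)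

Adjacent : (p : ℕ) .{{_ : NonZero p}} → ℕ → ℕ → ℕ → Set
Adjacent p D g0 g1 = dist p D g0 g1 ≡ 1

Contiguous : (p : ℕ) .{{_ : NonZero p}} → ℕ → (ℕ → Set) → Set
Contiguous p D S =
  Σ (List ℕ) λ xs → Unique xs × ((x : ℕ) → (x ∈ xs ⇔ S x)) × Linked (Adjacent p D) xs

{-# OPTIONS --safe #-}
module Submission where

-- Write A_i = { b_i + t D : 0 ≤ t ≤ m_i } with m_i = ⌊(p - 1 - b_i) / D⌋. Then the sums are the
-- numbers s + T D with s = Σ b_i and T ranging over exactly 0 … M, M = Σ m_i. Modulo p only T mod p
-- matters, so the sumset is listed by s + j D mod p for j < min (M + 1, p). These residues are
-- pairwise distinct because D is a unit mod p, and consecutive ones differ by D, i.e. are adjacent.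
-- The inverse D^(p-2) used by dist is justified by Fermat's little theorem, obtained from the
-- binomial theorem since p ∣ C(p,k) for 0 < k < p. If some b_i ≥ p the sumset is empty.

open import Defs
open import Data.Nat
open import Data.Nat.Properties
open import Data.Nat.DivMod
open import Data.Nat.Divisibility
open import Data.Nat.Primality using (Prime; euclidsLemma; prime⇒nonTrivial)
open import Data.Nat.Combinatorics using (_C_; nCk≡n!/k![n-k]!; k![n∸k]!∣n!; nCn≡1)
open import Data.Fin using (Fin; zero; suc; toℕ; inject₁; fromℕ)
open import Data.Fin.Properties using (toℕ<n; toℕ-inject₁; toℕ-fromℕ; any?)
open import Data.Vec.Functional using (Vector; init; last; _∷_)
open import Data.Product using (∃; _×_; _,_; Σ; proj₁; proj₂)
open import Data.Sum using (inj₁; inj₂)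
open import Data.Empty using (⊥-elim)
open import Data.List using ([]; applyUpTo)
open import Data.List.Membership.Propositional using (_∈_)
open import Data.List.Membership.Propositional.Properties using (∈-applyUpTo⁺; ∈-applyUpTo⁻)
open import Data.List.Relation.Unary.Unique.Propositional using (Unique; [])
open import Data.List.Relation.Unary.Linked using (Linked; [])
import Data.List.Relation.Unary.Unique.Propositional.Properties as Unique
import Data.List.Relation.Unary.Linked.Properties as Linked
open import Function using (_∘_; id)
open import Function.Bundles using (_⇔_; mk⇔; Equivalence)
import Function.Properties.Equivalence as ⇔
open import Relation.Nullary using (¬_; yes; no)
open import Relation.Binary.PropositionalEquality
open import Algebra.Properties.CommutativeMonoid.Sum +-0-commutativeMonoid using (sum; sum-cong-≗; sum-init-last; ∑-distrib-+)
open import Algebra.Properties.Semiring.Sum +-*-semiring using (*-distribʳ-sum)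
open import Algebra.Properties.CommutativeSemigroup +-commutativeSemigroup using (interchange; xy∙z≈y∙xz)
import Algebra.Properties.CommutativeSemiring.Binomial +-*-commutativeSemiring as Binomial
import Algebra.Definitions.RawSemiring +-*-rawSemiring as Raw

%≡%⇒∣∸ : ∀ {n} a b .{{_ : NonZero n}} → a % n ≡ b % n → n ∣ a ∸ b
%≡%⇒∣∸ {n} a b eq = divides (a / n ∸ b / n) (begin
  a ∸ b                                   ≡⟨ cong₂ _∸_ (m≡m%n+[m/n]*n a n) (m≡m%n+[m/n]*n b n) ⟩
  (a % n + a / n * n) ∸ (b % n + b / n * n) ≡⟨ cong (λ r → (a % n + a / n * n) ∸ (r + b / n * n)) (sym eq) ⟩
  (a % n + a / n * n) ∸ (a % n + b / n * n) ≡⟨ [m+n]∸[m+o]≡n∸o (a % n) _ _ ⟩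
  a / n * n ∸ b / n * n                   ≡⟨ *-distribʳ-∸ n (a / n) (b / n) ⟨
  (a / n ∸ b / n) * n                     ∎)
  where open ≡-Reasoning

∣∸⇒%≡% : ∀ {n a b} .{{_ : NonZero n}} → b ≤ a → n ∣ a ∸ b → a % n ≡ b % n
∣∸⇒%≡% {n} {a} {b} b≤a n∣a∸b = begin
  a % n             ≡⟨ cong (_% n) (m+[n∸m]≡n b≤a) ⟨
  (b + (a ∸ b)) % n ≡⟨ %-remove-+ʳ b n∣a∸b ⟩
  b % n             ∎
  where open ≡-Reasoning

[m%n+o]%n≡[m+o]%n : ∀ m o n .{{_ : NonZero n}} → (m % n + o) % n ≡ (m + o) % n
[m%n+o]%n≡[m+o]%n m o n = begin
  (m % n + o) % n         ≡⟨ %-distribˡ-+ (m % n) o n ⟩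
  (m % n % n + o % n) % n ≡⟨ cong (λ r → (r + o % n) % n) (m%n%n≡m%n m n) ⟩
  (m % n + o % n) % n     ≡⟨ %-distribˡ-+ m o n ⟨
  (m + o) % n             ∎
  where open ≡-Reasoning

[m+n%o]%o≡[m+n]%o : ∀ m n o .{{_ : NonZero o}} → (m + n % o) % o ≡ (m + n) % o
[m+n%o]%o≡[m+n]%o m n o = begin
  (m + n % o) % o ≡⟨ cong (_% o) (+-comm m (n % o)) ⟩
  (n % o + m) % o ≡⟨ [m%n+o]%n≡[m+o]%n n m o ⟩
  (n + m) % o     ≡⟨ cong (_% o) (+-comm n m) ⟩
  (m + n) % o     ∎
  where open ≡-Reasoning

[m*[n%o]]%o≡[m*n]%o : ∀ m n o .{{_ : NonZero o}} → (m * (n % o)) % o ≡ (m * n) % o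
[m*[n%o]]%o≡[m*n]%o m n o = begin
  (m * (n % o)) % o             ≡⟨ %-distribˡ-* m (n % o) o ⟩
  (m % o * (n % o % o)) % o     ≡⟨ cong (λ r → (m % o * r) % o) (m%n%n≡m%n n o) ⟩
  (m % o * (n % o)) % o         ≡⟨ %-distribˡ-* m n o ⟨
  (m * n) % o                   ∎
  where open ≡-Reasoning

∣∧<⇒≡0 : ∀ {m n} → n ∣ m → m < n → m ≡ 0
∣∧<⇒≡0 {zero}  _   _   = refl
∣∧<⇒≡0 {suc m} n∣m m<n = ⊥-elim (>⇒∤ m<n n∣m)

∣m*n∧∤m⇒∣n : ∀ {p a b} → Prime p → p ∤ a → p ∣ a * b → p ∣ b
∣m*n∧∤m⇒∣n {p} {a} {b} pr p∤a p∣ab with euclidsLemma a b pr p∣ab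
... | inj₁ p∣a = ⊥-elim (p∤a p∣a)
... | inj₂ p∣b = p∣b

prime∤* : ∀ {p a b} → Prime p → p ∤ a → p ∤ b → p ∤ a * b
prime∤* pr p∤a p∤b p∣ab = p∤b (∣m*n∧∤m⇒∣n pr p∤a p∣ab)

%≡%-*⇒∣∸ : ∀ {p a b c} → .{{_ : NonZero p}} → Prime p → p ∤ a → (a * b) % p ≡ (a * c) % p → p ∣ b ∸ c
%≡%-*⇒∣∸ {p} {a} {b} {c} pr p∤a eq =
  ∣m*n∧∤m⇒∣n pr p∤a (subst (p ∣_) (sym (*-distribˡ-∸ a b c)) (%≡%⇒∣∸ (a * b) (a * c) eq))

*-cancelˡ-% : ∀ {p a b c} → .{{_ : NonZero p}} → Prime p → p ∤ a → (a * b) % p ≡ (a * c) % p → b % p ≡ c % p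
*-cancelˡ-% {b = b} {c} pr p∤a eq with ≤-total c b
... | inj₁ c≤b = ∣∸⇒%≡% c≤b (%≡%-*⇒∣∸ pr p∤a eq)
... | inj₂ b≤c = sym (∣∸⇒%≡% b≤c (%≡%-*⇒∣∸ pr p∤a (sym eq)))

prime∤! : ∀ {p n} → Prime p → n < p → p ∤ n !
prime∤! {p} {zero}  pr _   p∣1 = nonTrivial⇒≢1 {{prime⇒nonTrivial pr}} (∣1⇒≡1 p∣1)
prime∤! {p} {suc n} pr n<p = prime∤* pr (>⇒∤ n<p) (prime∤! pr (<-trans (n<1+n n) n<p))

prime∣pCk : ∀ {p k} → Prime p → 0 < k → k < p → p ∣ p C k
prime∣pCk {p@(suc q)} {k} pr 0<k k<p = ∣m*n∧∤m⇒∣n pr (prime∤* pr (prime∤! pr k<p) (prime∤! pr p∸k<p))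
  (subst (p ∣_) (sym factorials*pCk≡p!) (m∣m*n (q !)))
  where
  p∸k<p : p ∸ k < p
  p∸k<p = ∸-monoʳ-< 0<k (<⇒≤ k<p)
  instance _ = k !* (p ∸ k) !≢0
  factorials*pCk≡p! : k ! * (p ∸ k) ! * (p C k) ≡ p !
  factorials*pCk≡p! = begin
    k ! * (p ∸ k) ! * (p C k)                 ≡⟨ *-comm _ (p C k) ⟩
    (p C k) * (k ! * (p ∸ k) !)               ≡⟨ cong (_* (k ! * (p ∸ k) !)) (nCk≡n!/k![n-k]! (<⇒≤ k<p)) ⟩
    p ! / (k ! * (p ∸ k) !) * (k ! * (p ∸ k) !) ≡⟨ m/n*n≡m (k![n∸k]!∣n! (<⇒≤ k<p)) ⟩
    p !                                         ∎
    where open ≡-Reasoning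

×≡* : ∀ n x → n Raw.× x ≡ n * x
×≡* zero    x = refl
×≡* (suc n) x = cong (x +_) (×≡* n x)

^≡^ : ∀ x n → x Raw.^ n ≡ x ^ n
^≡^ x zero    = refl
^≡^ x (suc n) = cong (x *_) (^≡^ x n)

[x+1]^n≡∑nCk*x^k : ∀ x n → (x + 1) ^ n ≡ sum (λ (k : Fin (suc n)) → (n C toℕ k) * x ^ toℕ k)
[x+1]^n≡∑nCk*x^k x n = begin
  (x + 1) ^ n                     ≡⟨ ^≡^ (x + 1) n ⟨
  (x + 1) Raw.^ n                 ≡⟨ Binomial.theorem n x 1 ⟩
  Binomial.binomialExpansion x 1 n ≡⟨ sum-cong-≗ {suc n} term ⟩
  sum {suc n} (λ k → (n C toℕ k) * x ^ toℕ k) ∎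
  where
  open ≡-Reasoning
  term : ∀ k → Binomial.binomialTerm x 1 n k ≡ (n C toℕ k) * x ^ toℕ k
  term k = begin
    (n C toℕ k) Raw.× (x Raw.^ toℕ k * 1 Raw.^ (n ∸ toℕ k)) ≡⟨ ×≡* (n C toℕ k) _ ⟩
    (n C toℕ k) * (x Raw.^ toℕ k * 1 Raw.^ (n ∸ toℕ k))     ≡⟨ cong₂ (λ u v → (n C toℕ k) * (u * v)) (^≡^ x (toℕ k)) (trans (^≡^ 1 (n ∸ toℕ k)) (^-zeroˡ (n ∸ toℕ k))) ⟩
    (n C toℕ k) * (x ^ toℕ k * 1)                           ≡⟨ cong ((n C toℕ k) *_) (*-identityʳ (x ^ toℕ k)) ⟩
    (n C toℕ k) * x ^ toℕ k                                 ∎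

∣-sum : ∀ {d n} (f : Vector ℕ n) → (∀ i → d ∣ f i) → d ∣ sum f
∣-sum {d} {zero}  f d∣f = d ∣0
∣-sum {d} {suc n} f d∣f = ∣m∣n⇒∣m+n (d∣f zero) (∣-sum (f ∘ suc) (d∣f ∘ suc))

sum-%-ends : ∀ {d} .{{_ : NonZero d}} n (f : Vector ℕ (suc (suc n))) →
             (∀ i → d ∣ f (suc (inject₁ i))) → sum f % d ≡ (f zero + f (suc (fromℕ n))) % d
sum-%-ends {d} n f d∣inner = begin
  sum f % d                            ≡⟨ cong (λ r → (f zero + r) % d) (sum-init-last (f ∘ suc)) ⟩
  (f zero + (inner + outer)) % d       ≡⟨ cong (λ r → (f zero + r) % d) (+-comm inner outer) ⟩
  (f zero + (outer + inner)) % d       ≡⟨ cong (_% d) (+-assoc (f zero) outer inner) ⟨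
  (f zero + outer + inner) % d         ≡⟨ %-remove-+ʳ (f zero + outer) (∣-sum (init (f ∘ suc)) d∣inner) ⟩
  (f zero + outer) % d                 ∎
  where
  open ≡-Reasoning
  inner = sum (init (f ∘ suc))
  outer = last (f ∘ suc)

freshman's-dream : ∀ {q} → Prime (suc q) → ∀ x → (x + 1) ^ suc q % suc q ≡ (x ^ suc q + 1) % suc q
freshman's-dream {q} pr x = begin
  (x + 1) ^ p % p              ≡⟨ cong (_% p) ([x+1]^n≡∑nCk*x^k x p) ⟩
  sum f % p                    ≡⟨ sum-%-ends q f inner ⟩
  (f zero + f (suc (fromℕ q))) % p ≡⟨ cong (λ r → (1 + r) % p) last≡x^p ⟩
  (1 + x ^ p) % p              ≡⟨ cong (_% p) (+-comm 1 (x ^ p)) ⟩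
  (x ^ p + 1) % p              ∎
  where
  open ≡-Reasoning
  p = suc q
  f : Vector ℕ (suc p)
  f k = (p C toℕ k) * x ^ toℕ k
  inner : ∀ i → p ∣ f (suc (inject₁ i))
  inner i = ∣m⇒∣m*n _ (prime∣pCk pr z<s (s≤s (subst (_< q) (sym (toℕ-inject₁ i)) (toℕ<n i))))
  last≡x^p : f (suc (fromℕ q)) ≡ x ^ p
  last≡x^p = begin
    (p C suc (toℕ (fromℕ q))) * x ^ suc (toℕ (fromℕ q)) ≡⟨ cong (λ j → (p C suc j) * x ^ suc j) (toℕ-fromℕ q) ⟩
    (p C p) * x ^ p                                     ≡⟨ cong (_* x ^ p) (nCn≡1 p) ⟩
    1 * x ^ p                                           ≡⟨ *-identityˡ (x ^ p) ⟩
    x ^ p                                               ∎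

fermat-little : ∀ {p} → .{{_ : NonZero p}} → Prime p → ∀ x → x ^ p % p ≡ x % p
fermat-little {suc q} pr zero    = refl
fermat-little {p@(suc q)} pr (suc x) = begin
  (1 + x) ^ p % p         ≡⟨ cong (λ y → y ^ p % p) (+-comm 1 x) ⟩
  (x + 1) ^ p % p         ≡⟨ freshman's-dream pr x ⟩
  (x ^ p + 1) % p         ≡⟨ [m%n+o]%n≡[m+o]%n (x ^ p) 1 p ⟨
  (x ^ p % p + 1) % p     ≡⟨ cong (λ y → (y + 1) % p) (fermat-little pr x) ⟩
  (x % p + 1) % p         ≡⟨ [m%n+o]%n≡[m+o]%n x 1 p ⟩
  (x + 1) % p             ≡⟨ cong (_% p) (+-comm x 1) ⟩
  (1 + x) % p             ∎
  where
  open ≡-Reasoning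

D*inv%p≡1 : ∀ {p} → .{{_ : NonZero p}} → Prime p → ∀ {D} → p ∤ D → (D * inv p D) % p ≡ 1
D*inv%p≡1 {p@(2+ q)} pr {D} p∤D = begin
  D * (D ^ q % p) % p ≡⟨ [m*[n%o]]%o≡[m*n]%o D (D ^ q) p ⟩
  D ^ suc q % p       ≡⟨ *-cancelˡ-% pr p∤D D^p≡D*1 ⟩
  1 % p               ≡⟨ m<n⇒m%n≡m (nonTrivial⇒n>1 p {{prime⇒nonTrivial pr}}) ⟩
  1                   ∎
  where
  open ≡-Reasoning
  D^p≡D*1 : (D * D ^ suc q) % p ≡ (D * 1) % p
  D^p≡D*1 = trans (fermat-little pr D) (cong (_% p) (sym (*-identityʳ D)))

∑-mono-≤ : ∀ {k} {f g : Vector ℕ k} → (∀ i → f i ≤ g i) → sum f ≤ sum g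
∑-mono-≤ {zero}  f≤g = z≤n
∑-mono-≤ {suc k} f≤g = +-mono-≤ (f≤g zero) (∑-mono-≤ (f≤g ∘ suc))

≤∑⇒∑-of-≤ : ∀ {k} (m : Vector ℕ k) {T} → T ≤ sum m → ∃ λ t → (∀ i → t i ≤ m i) × sum t ≡ T
≤∑⇒∑-of-≤ {zero}  m z≤n = (λ ()) , (λ ()) , refl
≤∑⇒∑-of-≤ {suc k} m {T} T≤∑m with ≤∑⇒∑-of-≤ (m ∘ suc) (m≤n+o⇒m∸n≤o T (m zero) T≤∑m)
... | t , t≤m , ∑t≡ = (m zero ⊓ T) ∷ t , t′≤m , trans (cong (m zero ⊓ T +_) ∑t≡) (m⊓n+n∸m≡n (m zero) T)
  where
  t′≤m : ∀ i → ((m zero ⊓ T) ∷ t) i ≤ m i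
  t′≤m zero    = m⊓n≤m (m zero) T
  t′≤m (suc i) = t≤m i

∑[b+t*D]≡∑b+∑t*D : ∀ {k} (b t : Vector ℕ k) D → sum (λ i → b i + t i * D) ≡ sum b + sum t * D
∑[b+t*D]≡∑b+∑t*D b t D = trans (∑-distrib-+ b (λ i → t i * D)) (cong (sum b +_) (sym (*-distribʳ-sum D t)))

*≤⇔≤/ : ∀ {t D c} .{{_ : NonZero D}} → t * D ≤ c ⇔ t ≤ c / D
*≤⇔≤/ {t} {D} {c} = mk⇔
  (λ t*D≤c → subst (_≤ c / D) (m*n/n≡m t D) (/-monoˡ-≤ D t*D≤c))
  (λ t≤c/D → ≤-trans (*-monoˡ-≤ D t≤c/D) (m/n*n≤m c D))

+*<⇔≤/ : ∀ {p b t D} .{{_ : NonZero D}} → b < p → b + t * D < p ⇔ t ≤ (p ∸ suc b) / D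
+*<⇔≤/ {p} {b} {t} {D} b<p = ⇔.trans (mk⇔ to from) *≤⇔≤/
  where
  to : b + t * D < p → t * D ≤ p ∸ suc b
  to lt = m+n≤o⇒m≤o∸n (t * D) (subst (_≤ p) (+-comm (suc b) (t * D)) lt)
  from : t * D ≤ p ∸ suc b → b + t * D < p
  from le = subst (_≤ p) (+-comm (t * D) (suc b)) (m≤o∸n⇒m+n≤o (t * D) b<p le)

AP⇔ : ∀ {p D b x} .{{_ : NonZero D}} → b < p → AP p D b x ⇔ ∃ λ t → t ≤ (p ∸ suc b) / D × x ≡ b + t * D
AP⇔ {p} {D} {b} {x} b<p = mk⇔
  (λ { (x<p , t , refl) → t , Equivalence.to (+*<⇔≤/ b<p) x<p , refl })
  (λ { (t , t≤ , refl) → Equivalence.from (+*<⇔≤/ b<p) t≤ , t , refl })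

AP-empty : ∀ {p D b x} → p ≤ b → ¬ AP p D b x
AP-empty {D = D} {b} p≤b (x<p , t , refl) = <⇒≱ x<p (≤-trans p≤b (m≤m+n b (t * D)))

subMod[u+d]u≡d%p : ∀ {p u} .{{_ : NonZero p}} d → u < p → subMod p ((u + d) % p) u ≡ d % p
subMod[u+d]u≡d%p {p} {u} d u<p = begin
  ((u + d) % p + (p ∸ u)) % p ≡⟨ [m%n+o]%n≡[m+o]%n (u + d) (p ∸ u) p ⟩
  (u + d + (p ∸ u)) % p       ≡⟨ cong (_% p) (xy∙z≈y∙xz u d (p ∸ u)) ⟩
  (d + (u + (p ∸ u))) % p     ≡⟨ cong (λ r → (d + r) % p) (m+[n∸m]≡n (<⇒≤ u<p)) ⟩
  (d + p) % p                 ≡⟨ [m+n]%n≡m%n d p ⟩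
  d % p                       ∎
  where open ≡-Reasoning

[subMod+subMod]%p≡0 : ∀ {p u v} .{{_ : NonZero p}} → u < p → v < p → (subMod p u v + subMod p v u) % p ≡ 0
[subMod+subMod]%p≡0 {p} {u} {v} u<p v<p = begin
  ((u + (p ∸ v)) % p + (v + (p ∸ u)) % p) % p ≡⟨ %-distribˡ-+ (u + (p ∸ v)) (v + (p ∸ u)) p ⟨
  ((u + (p ∸ v)) + (v + (p ∸ u))) % p         ≡⟨ cong (λ r → ((u + (p ∸ v)) + r) % p) (+-comm v (p ∸ u)) ⟩
  ((u + (p ∸ v)) + ((p ∸ u) + v)) % p         ≡⟨ cong (_% p) (interchange u (p ∸ v) (p ∸ u) v) ⟩
  ((u + (p ∸ u)) + ((p ∸ v) + v)) % p         ≡⟨ cong₂ (λ r s → (r + s) % p) (m+[n∸m]≡n (<⇒≤ u<p)) (m∸n+n≡m (<⇒≤ v<p)) ⟩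
  (p + p) % p                                 ≡⟨ [m+n]%n≡m%n p p ⟩
  p % p                                       ≡⟨ n%n≡0 p ⟩
  0                                           ∎
  where open ≡-Reasoning

adjacent-+D : ∀ {p D u} .{{_ : NonZero p}} → Prime p → p ∤ D → u < p → Adjacent p D u ((u + D) % p)
adjacent-+D {p} {D} {u} pr p∤D u<p = begin
  forward ⊓ backward ≡⟨ cong (_⊓ backward) forward≡1 ⟩
  1 ⊓ backward       ≡⟨ m≤n⇒m⊓n≡m (n≢0⇒n>0 backward≢0) ⟩
  1                  ∎
  where
  open ≡-Reasoning
  v = (u + D) % p
  I = inv p D
  forward = (subMod p v u * I) % p
  backward = (subMod p u v * I) % p
  forward≡1 : forward ≡ 1
  forward≡1 = begin
    (subMod p v u * I) % p ≡⟨ cong (λ r → (r * I) % p) (subMod[u+d]u≡d%p D u<p) ⟩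
    (D % p * I) % p        ≡⟨ cong (_% p) (*-comm (D % p) I) ⟩
    (I * (D % p)) % p      ≡⟨ [m*[n%o]]%o≡[m*n]%o I D p ⟩
    (I * D) % p            ≡⟨ cong (_% p) (*-comm I D) ⟩
    (D * I) % p            ≡⟨ D*inv%p≡1 pr p∤D ⟩
    1                      ∎
  p∤I : p ∤ I
  p∤I p∣I = 0≢1+n (trans (sym (n∣m⇒m%n≡0 (D * I) p (∣n⇒∣m*n D p∣I))) (D*inv%p≡1 pr p∤D))
  -- The two differences u - v and v - u ≡ D cancel mod p, so u - v vanishes only if p ∣ D.
  backward≢0 : backward ≢ 0
  backward≢0 backward≡0 = p∤D (m%n≡0⇒n∣m D p (begin
    D % p                               ≡⟨ subMod[u+d]u≡d%p D u<p ⟨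
    subMod p v u                        ≡⟨ m%n%n≡m%n (v + (p ∸ u)) p ⟨
    (0 + subMod p v u) % p              ≡⟨ cong (λ r → (r + subMod p v u) % p) subMod≡0 ⟨
    (subMod p u v + subMod p v u) % p   ≡⟨ [subMod+subMod]%p≡0 u<p (m%n<n (u + D) p) ⟩
    0                                   ∎))
    where
    subMod≡0 : subMod p u v ≡ 0
    subMod≡0 = ∣∧<⇒≡0 (∣m*n∧∤m⇒∣n pr p∤I (subst (p ∣_) (*-comm _ I) (m%n≡0⇒n∣m _ p backward≡0)))
                      (m%n<n (u + (p ∸ v)) p)

progression : (p : ℕ) .{{_ : NonZero p}} → ℕ → ℕ → ℕ → ℕ
progression p D s j = (s + j * D) % p

progression-suc : ∀ {p} .{{_ : NonZero p}} D s j → progression p D s (suc j) ≡ (progression p D s j + D) % p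
progression-suc {p} D s j = begin
  (s + (D + j * D)) % p   ≡⟨ cong (λ r → (s + r) % p) (+-comm D (j * D)) ⟩
  (s + (j * D + D)) % p   ≡⟨ cong (_% p) (+-assoc s (j * D) D) ⟨
  (s + j * D + D) % p     ≡⟨ [m%n+o]%n≡[m+o]%n (s + j * D) D p ⟨
  ((s + j * D) % p + D) % p ∎
  where open ≡-Reasoning

module _ {p} .{{_ : NonZero p}} {D} (pr : Prime p) (p∤D : p ∤ D) (s : ℕ) where

  progression-injective : ∀ {i j} → i < j → j < p → progression p D s i ≢ progression p D s j
  progression-injective {i} {j} i<j j<p eq = m>n⇒m∸n≢0 i<j (∣∧<⇒≡0 p∣j∸i (≤-<-trans (m∸n≤m j i) j<p))
    where
    p∣j∸i : p ∣ j ∸ i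
    p∣j∸i = ∣m*n∧∤m⇒∣n pr p∤D (subst (p ∣_)
      (trans ([m+n]∸[m+o]≡n∸o s (j * D) (i * D)) (trans (sym (*-distribʳ-∸ D j i)) (*-comm (j ∸ i) D)))
      (%≡%⇒∣∸ (s + j * D) (s + i * D) (sym eq)))

  progression-unique : ∀ {n} → n ≤ p → Unique (applyUpTo (progression p D s) n)
  progression-unique n≤p = Unique.applyUpTo⁺₁ _ _ (λ i<j j<n → progression-injective i<j (<-≤-trans j<n n≤p))

  progression-linked : ∀ n → Linked (Adjacent p D) (applyUpTo (progression p D s) n)
  progression-linked n = Linked.applyUpTo⁺₂ _ n (λ j →
    subst (Adjacent p D _) (sym (progression-suc D s j)) (adjacent-+D pr p∤D (m%n<n (s + j * D) p)))

progression-mod : ∀ {p} .{{_ : NonZero p}} D s j → progression p D s (j % p) ≡ progression p D s j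
progression-mod {p} D s j = begin
  (s + j % p * D) % p          ≡⟨ [m+n%o]%o≡[m+n]%o s (j % p * D) p ⟨
  (s + (j % p * D) % p) % p    ≡⟨ cong (λ r → (s + r) % p) j%p*D≡j*D ⟩
  (s + (j * D) % p) % p        ≡⟨ [m+n%o]%o≡[m+n]%o s (j * D) p ⟩
  (s + j * D) % p              ∎
  where
  open ≡-Reasoning
  j%p*D≡j*D : (j % p * D) % p ≡ (j * D) % p
  j%p*D≡j*D = begin
    (j % p * D) % p             ≡⟨ %-distribˡ-* (j % p) D p ⟩
    (j % p % p * (D % p)) % p   ≡⟨ cong (λ r → (r * (D % p)) % p) (m%n%n≡m%n j p) ⟩
    (j % p * (D % p)) % p       ≡⟨ %-distribˡ-* j D p ⟨
    (j * D) % p                 ∎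

∈-progression⇔ : ∀ {p} .{{_ : NonZero p}} D s M x →
                 x ∈ applyUpTo (progression p D s) (suc M ⊓ p) ⇔ ∃ λ T → T ≤ M × x ≡ progression p D s T
∈-progression⇔ {p} D s M x = mk⇔ to from
  where
  to : x ∈ applyUpTo (progression p D s) (suc M ⊓ p) → ∃ λ T → T ≤ M × x ≡ progression p D s T
  to x∈ with ∈-applyUpTo⁻ (progression p D s) x∈
  ... | j , j<n , x≡ = j , s≤s⁻¹ (m<n⊓o⇒m<n (suc M) p j<n) , x≡
  from : (∃ λ T → T ≤ M × x ≡ progression p D s T) → x ∈ applyUpTo (progression p D s) (suc M ⊓ p)
  from (T , T≤M , refl) = subst (_∈ _) (progression-mod D s T)
    (∈-applyUpTo⁺ (progression p D s) (⊓-pres-m< (s≤s (≤-trans (m%n≤m T p) T≤M)) (m%n<n T p)))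

-- Sumset sums its summands with a function local to Defs; unification against Sumset's type names it.
sumsetSum : (p : ℕ) .{{_ : NonZero p}} (k : ℕ) (A : Fin k → ℕ → Set) (x : ℕ) → Vector ℕ k → ℕ
sumsetSum p k A x = sumOf id
  where
  sumOf : {F : Vector ℕ k → ℕ} →
          (Sumset p k A x → Σ (Vector ℕ k) λ a → ((i : Fin k) → A i (a i)) × (x ≡ F a % p)) → Vector ℕ k → ℕ
  sumOf {F} _ = F

sumsetSum≡sum : ∀ {p} .{{_ : NonZero p}} k (A : Fin k → ℕ → Set) x (a : Vector ℕ k) → sumsetSum p k A x a ≡ sum a
sumsetSum≡sum zero    A x a = refl
sumsetSum≡sum (suc k) A x a = cong (a zero +_) (sumsetSum≡sum k (A ∘ suc) x (a ∘ suc))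

Sumset-AP⇔ : ∀ {p D k} .{{_ : NonZero p}} .{{_ : NonZero D}} (b : Vector ℕ k) → (∀ i → b i < p) → ∀ x →
             Sumset p k (λ i → AP p D (b i)) x ⇔
             ∃ λ T → T ≤ sum (λ i → (p ∸ suc (b i)) / D) × x ≡ progression p D (sum b) T
Sumset-AP⇔ {p} {D} {k} b b<p x = mk⇔ to from
  where
  A = λ i → AP p D (b i)
  m = λ i → (p ∸ suc (b i)) / D
  to : Sumset p k A x → ∃ λ T → T ≤ sum m × x ≡ progression p D (sum b) T
  to (a , a∈A , x≡∑a) = sum t , ∑-mono-≤ (proj₁ ∘ proj₂ ∘ summand) , trans x≡∑a (cong (_% p) ∑a≡)
    where
    summand : ∀ i → ∃ λ t → t ≤ m i × a i ≡ b i + t * D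
    summand i = Equivalence.to (AP⇔ (b<p i)) (a∈A i)
    t = proj₁ ∘ summand
    ∑a≡ : sumsetSum p k A x a ≡ sum b + sum t * D
    ∑a≡ = begin
      sumsetSum p k A x a         ≡⟨ sumsetSum≡sum {p} k A x a ⟩
      sum a                       ≡⟨ sum-cong-≗ (proj₂ ∘ proj₂ ∘ summand) ⟩
      sum (λ i → b i + t i * D)   ≡⟨ ∑[b+t*D]≡∑b+∑t*D b t D ⟩
      sum b + sum t * D           ∎
      where open ≡-Reasoning
  from : (∃ λ T → T ≤ sum m × x ≡ progression p D (sum b) T) → Sumset p k A x
  from (T , T≤∑m , x≡prog) with ≤∑⇒∑-of-≤ m T≤∑m
  ... | t , t≤m , refl = a , (λ i → Equivalence.from (AP⇔ (b<p i)) (t i , t≤m i , refl)) ,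
                         trans x≡prog (cong (_% p) (sym (trans (sumsetSum≡sum {p} k A x a) (∑[b+t*D]≡∑b+∑t*D b t D))))
    where
    a = λ i → b i + t i * D

contiguous-∅ : ∀ {p D} .{{_ : NonZero p}} {S : ℕ → Set} → (∀ x → ¬ S x) → Contiguous p D S
contiguous-∅ ¬S = [] , [] , (λ x → mk⇔ (λ ()) (⊥-elim ∘ ¬S x)) , []

lemma8 : (p : ℕ) .{{_ : NonZero p}} → Prime p → (D : ℕ) → 1 ≤ D → ¬ (p ∣ D) →
         (k : ℕ) → 1 ≤ k → (b : Fin k → ℕ) → ((i : Fin k) → b i < D) →
         Contiguous p D (Sumset p k (λ i → AP p D (b i)))
lemma8 p pr D 1≤D p∤D k _ b _ with any? (λ i → p ≤? b i)
... | yes (i , p≤bᵢ) = contiguous-∅ (λ { x (a , a∈A , _) → AP-empty p≤bᵢ (a∈A i) })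
... | no  ¬p≤b       =
  applyUpTo (progression p D (sum b)) (suc M ⊓ p) ,
  progression-unique pr p∤D (sum b) (m⊓n≤n (suc M) p) ,
  (λ x → ⇔.trans (∈-progression⇔ D (sum b) M x) (⇔.sym (Sumset-AP⇔ b b<p x))) ,
  progression-linked pr p∤D (sum b) (suc M ⊓ p)
  where
  instance _ = >-nonZero 1≤D
  b<p : ∀ i → b i < p
  b<p i = ≰⇒> (¬p≤b ∘ (i ,_))
  M = sum (λ i → (p ∸ suc (b i)) / D)
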